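{- Let $\mathcal{T}$ be a progressing timed MSR system (PTS), $\mathcal{S}_0$ an initial configuration and $\mathcal{CS}$ a critical configuration specification, with properties taken with respect to $\mathcal{S}_0$, $\mathcal{CS}$ and lazy time sampling. If $\mathcal{T}$ satisfies the $S$ property, then $\mathcal{T}$ satisfies the $L$ property. Conversely, a PTS satisfying the $L$ property need not satisfy the $S$ property: there exist a PTS, an initial configuration and a critical configuration specification for which $L$ holds but $S$ fails.
   Context: A fact is $P(u_1,\dots,u_n)$ over a finite first-order typed alphabet; a timestamped fact is $F@t$, $t\in\mathbb{N}$. A configuration is a finite multiset of ground timestamped facts with exactly one fact $Time@t$ (global time $t$). The $Tick$ rule is $Time@T\to Time@(T+1)$. An instantaneous rule has the form $Time@T, W_1@T_1,\dots,W_p@T_p, F_1@T_1',\dots,F_n@T_n' \mid \mathcal{C} \to \exists \vec X.[Time@T, W_1@T_1,\dots,W_p@T_p, Q_1@(T+d_1),\dots,Q_m@(T+d_m)]$ with $d_i\in\mathbb{N}$, $\mathcal{C}$ a set of constraints $T_a>T_b\pm d$ or $T_a=T_b\pm d$ over the precondition's time variables, $\vec X$ fresh values; the $F_i@T_i'$ are consumed and the $Q_i@(T+d_i)$ created. A rule $\mathcal{W}\mid\mathcal{C}\to\exists\vec X.\mathcal{W}'$ applies to $\mathcal{S}$ if for a ground substitution $\sigma$, $\mathcal{W}\sigma\subseteq\mathcal{S}$ and $\mathcal{C}\sigma$ holds, giving $((\mathcal{S}\setminus\mathcal{W})\cup\mathcal{W}')\sigma$. A timed MSR system is a set of instantaneous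 rules plus $Tick$; it is balanced if every instantaneous rule has $m=n$; it is a PTS if it is balanced and every instantaneous rule (i) has $d_i\ge1$ for at least one $i$ and (ii) has $\mathcal{C}$ containing $T\ge T_i'$ for each consumed $F_i@T_i'$. A trace is a finite or infinite sequence of single rule applications; an infinite time trace is one in which the global time exceeds every $n\in\mathbb{N}$. A critical configuration specification is a set of pairs $\langle\mathcal{S}_j,\mathcal{C}_j\rangle$, $\mathcal{S}_j$ a finite multiset of facts $F@T$ with time variables, $\mathcal{C}_j$ constraints on them; $\mathcal{S}$ is critical if some $\mathcal{S}_j\sigma\subseteq\mathcal{S}$ with $\mathcal{C}_j\sigma$ true for a ground substitution $\sigma$ (nonces renamed). A trace is compliant if it contains no critical configuration. A trace uses lazy time sampling (l.t.s.) if whenever $\mathcal{S}_i\to_{Tick}\mathcal{S}_{i+1}$ occurs, no instantaneous rule instance is applicable to $\mathcal{S}_i$. $Z$ property: there is a compliant infinite time trace from $\mathcal{S}_0$ using l.t.s. $S$ property: $Z$ holds and every infinite time trace from $\mathcal{S}_0$ using l.t.s. is compliant. $L$ property: $Z$ holds and for every configuration $\mathcal{S}$ reachable from $\mathcal{S}_0$ by a compliant trace using l.t.s., there is a compliant infinite time trace from $\mathcal{S}$ using l.t.s. -}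

module Defs where

open import Data.Nat using (ℕ; suc; _+_; _<_; _≤_)
open import Data.Fin using (Fin)
open import Data.List using (List; []; _∷_; _++_; map; length)
open import Data.List.Membership.Propositional using (_∈_)
open import Data.List.Relation.Unary.All using (All)
open import Data.List.Relation.Unary.Any using (Any)
open import Data.List.Relation.Binary.Permutation.Propositional using (_↭_)
open import Data.Vec using (Vec; toList; zipWith)
open import Data.Product using (Σ; _×_; _,_; ∃)
open import Data.Sum using (_⊎_; [_,_])
open import Data.Empty using (⊥)
open import Data.Unit using (⊤)
open import Relation.Nullary using (¬_)
open import Relation.Binary.PropositionalEquality using (_≡_)
open import Function.Definitions using (Injective)

-- Term V : terms whose variables range over V.
--   con c    : constant symbol c of the alphabet
--   fun f ts : function symbol f applied to ts
-- Ground terms appearing in configurations are  Term Nonce  : there a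
-- "variable" var n denotes the (fresh) value / nonce n.

data Term (V : Set) : Set where
  var : V → Term V
  con : ℕ → Term V
  fun : ℕ → List (Term V) → Term V

mutual
  subT : {V W : Set} → (V → Term W) → Term V → Term W
  subT σ (var v)    = σ v
  subT σ (con c)    = con c
  subT σ (fun f ts) = fun f (subL σ ts)

  subL : {V W : Set} → (V → Term W) → List (Term V) → List (Term W)
  subL σ []       = []
  subL σ (t ∷ ts) = subT σ t ∷ subL σ ts

data Fact (V : Set) : Set where
  fact : ℕ → List (Term V) → Fact V

subF : {V W : Set} → (V → Term W) → Fact V → Fact W
subF σ (fact P us) = fact P (subL σ us)

Nonce : Set
Nonce = ℕ

GTerm : Set
GTerm = Term Nonce

GFact : Set
GFact = Fact Nonce

TFact : Set
TFact = GFact × ℕ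

-- A configuration: the unique fact Time@time, plus the multiset (list up
-- to permutation) of the remaining ground timestamped facts.
record Config : Set where
  constructor ⟪_,_⟫
  field
    time  : ℕ
    facts : List TFact
open Config public

mutual
  OccT : Nonce → GTerm → Set
  OccT n (var m)    = n ≡ m
  OccT n (con c)    = ⊥
  OccT n (fun f ts) = OccL n ts

  OccL : Nonce → List GTerm → Set
  OccL n []       = ⊥
  OccL n (t ∷ ts) = OccT n t ⊎ OccL n ts

OccF : Nonce → TFact → Set
OccF n (fact P us , t) = OccL n us

OccC : Nonce → Config → Set
OccC n S = Any (OccF n) (facts S)

-- Time constraints  Ta > Tb ± d  and  Ta = Tb ± d  (integer reading)

data Rel : Set where
  gt eq : Rel

data Sign : Set where
  plus minus : Sign

data Constraint (A : Set) : Set where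
  constr : Rel → A → A → Sign → ℕ → Constraint A

Holds : {A : Set} → (A → ℕ) → Constraint A → Set
Holds τ (constr gt a b plus d)  = τ b + d < τ a
Holds τ (constr gt a b minus d) = τ b < τ a + d        -- Ta > Tb - d
Holds τ (constr eq a b plus d)  = τ a ≡ τ b + d
Holds τ (constr eq a b minus d) = τ a + d ≡ τ b        -- Ta = Tb - d

-- Ta ≥ Tb, i.e. Ta > Tb - 1
_≥c_ : {A : Set} → A → A → Constraint A
a ≥c b = constr gt a b minus 1

-- Instantaneous rules
--   Time@T, W_1@T_1..W_p@T_p, F_1@T'_1..F_n@T'_n | C
--     → ∃X. Time@T, W_1@T_1..W_p@T_p, Q_1@(T+d_1)..Q_m@(T+d_m)
-- Each precondition fact carries its own time variable.

data TVar (p n : ℕ) : Set where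
  tT : TVar p n
  tW : Fin p → TVar p n
  tF : Fin n → TVar p n

record Rule : Set where
  field
    nv   : ℕ
    nx   : ℕ
    p    : ℕ
    n    : ℕ
    W    : Vec (Fact (Fin nv)) p
    F    : Vec (Fact (Fin nv)) n
    C    : List (Constraint (TVar p n))
    Q    : List (Fact (Fin nv ⊎ Fin nx) × ℕ)
open Rule public

timedInst : {V : Set} {k : ℕ} → (V → GTerm) → Vec (Fact V) k → Vec ℕ k → List TFact
timedInst σ fs ts = toList (zipWith (λ f t → subF σ f , t) fs ts)

record Application (r : Rule) (S S' : Config) : Set where
  field
    σ     : Fin (nv r) → GTerm
    ξ     : Fin (nx r) → Nonce
    tw    : Vec ℕ (p r)
    tf    : Vec ℕ (n r)
    rest  : List TFact
    fresh-inj : Injective _≡_ _≡_ ξ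
    fresh     : ∀ x → ¬ OccC (ξ x) S
    constraints : All (Holds (λ { tT → time S
                                ; (tW i) → Data.Vec.lookup tw i
                                ; (tF i) → Data.Vec.lookup tf i })) (C r)
    pre   : facts S ↭ timedInst σ (W r) tw ++ timedInst σ (F r) tf ++ rest
    time≡ : time S' ≡ time S
    post  : facts S' ↭ timedInst σ (W r) tw
                        ++ map (λ { (q , d) → subF [ σ , (λ x → var (ξ x)) ] q , time S + d }) (Q r)
                        ++ rest

-- timed MSR system: its finite set of instantaneous rules (Tick is implicit)
System : Set
System = List Rule

InstStep : System → Config → Config → Set
InstStep R S S' = Σ Rule (λ r → r ∈ R × Application r S S')

InstApplicable : System → Config → Set
InstApplicable R S = ∃ (λ S' → InstStep R S S')

data Step (R : System) : Config → Config → Set where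
  tick : ∀ {t fs} → Step R ⟪ t , fs ⟫ ⟪ suc t , fs ⟫
  inst : ∀ {S S'} → InstStep R S S' → Step R S S'

IsTick : ∀ {R S S'} → Step R S S' → Set
IsTick tick     = ⊤
IsTick (inst _) = ⊥

LazyStep : System → Config → Config → Set
LazyStep R S S' = Σ (Step R S S') (λ st → IsTick st → ¬ InstApplicable R S)

Balanced : System → Set
Balanced R = All (λ r → length (Q r) ≡ n r) R

IsPTS : System → Set
IsPTS R = Balanced R
        × All (λ r → Any (λ q → 1 ≤ Data.Product.proj₂ q) (Q r)
                   × (∀ (i : Fin (n r)) → (tT ≥c tF i) ∈ C r)) R

-- Critical configuration specifications.
-- A pair ⟨S_j , C_j⟩: facts F_i@T_i (each with its own time variable);
-- constraints may also mention the global time T (i.e. a fact Time@T of S_j).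

data CVar (k : ℕ) : Set where
  cT : CVar k
  cF : Fin k → CVar k

record CritPair : Set where
  field
    cnv : ℕ
    k   : ℕ
    cfacts : Vec (Fact (Fin cnv)) k
    cC     : List (Constraint (CVar k))
open CritPair public

CritSpec : Set
CritSpec = List CritPair

MatchesPair : CritPair → Config → Set
MatchesPair P S =
  Σ (Fin (cnv P) → GTerm) λ σ → Σ (Vec ℕ (k P)) λ ts → Σ (List TFact) λ rest →
    (facts S ↭ timedInst σ (cfacts P) ts ++ rest)
  × All (Holds (λ { cT → time S ; (cF i) → Data.Vec.lookup ts i })) (cC P)

Critical : CritSpec → Config → Set
Critical CS S = Any (λ P → MatchesPair P S) CS

data CompliantReach (R : System) (CS : CritSpec) (S0 : Config) : Config → Set where
  start : ¬ Critical CS S0 → CompliantReach R CS S0 S0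
  step  : ∀ {S S'} → CompliantReach R CS S0 S → LazyStep R S S' → ¬ Critical CS S'
        → CompliantReach R CS S0 S'

LazyRun : System → Config → (ℕ → Config) → Set
LazyRun R S ρ = ρ 0 ≡ S × (∀ i → LazyStep R (ρ i) (ρ (suc i)))

InfiniteTime : (ℕ → Config) → Set
InfiniteTime ρ = ∀ m → ∃ λ i → m < time (ρ i)

CompliantRun : CritSpec → (ℕ → Config) → Set
CompliantRun CS ρ = ∀ i → ¬ Critical CS (ρ i)

ZProp : System → Config → CritSpec → Set
ZProp R S0 CS = ∃ λ ρ → LazyRun R S0 ρ × InfiniteTime ρ × CompliantRun CS ρ

SProp : System → Config → CritSpec → Set
SProp R S0 CS = ZProp R S0 CS
  × (∀ ρ → LazyRun R S0 ρ → InfiniteTime ρ → CompliantRun CS ρ)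

LProp : System → Config → CritSpec → Set
LProp R S0 CS = ZProp R S0 CS
  × (∀ S → CompliantReach R CS S0 S → ZProp R S CS)

{-# OPTIONS --safe #-}

-- S ⇒ L: compliance of all lazy infinite-time runs passes from a configuration to its lazy
-- successors (prepend the step), hence to every compliantly reachable configuration, so it is
-- enough that every configuration has some lazy infinite-time run.  In a PTS an instantaneous
-- step keeps the time and decreases the number of facts whose timestamp is not in the future,
-- so the greedy run (apply a rule if one applies, else Tick) ticks again and again.  The greedy
-- choice is constructive because applicability is decidable: an instance is fixed by the facts
-- it uses and a matching substitution, and only finitely many substitutions need be tried.
module Submission where

open import Defs
open import Data.Product using (Σ; _×_; _,_; proj₁; proj₂; ∃)
open import Relation.Nullary using (¬_)

open import Data.Nat as ℕ using (ℕ; zero; suc; _+_; _<_; _≤_; _⊔_; _<?_; _≤?_)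
import Data.Nat.Properties as ℕ
open import Data.Nat.Induction using (<-wellFounded)
open import Induction.WellFounded using (Acc; acc)
open import Data.Fin using (Fin; toℕ) renaming (zero to fzero; suc to fsuc)
import Data.Fin.Properties as Fin
open import Data.List using (List; []; _∷_; _++_; [_]; map; concatMap; length; filter)
import Data.List.Properties as List
open import Data.List.Membership.Propositional using (_∈_; find; lose)
open import Data.List.Membership.Propositional.Properties using (∈-map⁺; ∈-concatMap⁺; ∈-++⁺ˡ; ∈-++⁺ʳ)
open import Data.List.Relation.Unary.All as All using (All; []; _∷_)
import Data.List.Relation.Unary.All.Properties as All
open import Data.List.Relation.Unary.Any as Any using (Any; here; there; any?)
import Data.List.Relation.Unary.Any.Properties as Any
open import Data.List.Relation.Binary.Permutation.Propositional using (_↭_; ↭-refl; ↭-sym; ↭-trans; ↭-reflexive; prep; swap)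
open import Data.List.Relation.Binary.Permutation.Propositional.Properties
  using (∈-resp-↭; All-resp-↭; drop-∷; ++⁺ˡ; ↭-length; filter-↭)
open import Data.Vec as Vec using (Vec; []; _∷_; toList; lookup; tabulate; zipWith)
import Data.Vec.Properties as Vec
open import Data.Vec.Properties using (lookup∘tabulate)
open import Data.Sum as Sum using (_⊎_; inj₁; inj₂)
open import Relation.Nullary using (Dec; yes; no; contradiction)
open import Function using (_∘_; id)
open import Function.Definitions using (Injective)
open import Relation.Nullary.Decidable using (map′; _×-dec_)
open import Relation.Binary.PropositionalEquality using (_≡_; _≢_; _≗_; refl; sym; trans; cong; cong₂; subst; subst₂)

module Enumeration {A : Set} where

  Pick : List A → Set
  Pick xs = Σ A λ y → Σ (List A) λ ys → xs ↭ y ∷ ys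

  picks : (xs : List A) → List (Pick xs)
  picks []       = []
  picks (x ∷ xs) = (x , xs , ↭-refl) ∷ map (λ { (y , ys , p) → y , x ∷ ys , ↭-trans (prep x p) (swap x y ↭-refl) }) (picks xs)

  picks-complete : ∀ {y xs} → y ∈ xs → Any (λ e → proj₁ e ≡ y) (picks xs)
  picks-complete (here refl) = here refl
  picks-complete (there y∈xs) = there (Any.map⁺ (picks-complete y∈xs))

  Split : ℕ → List A → Set
  Split k xs = Σ (Vec A k) λ v → Σ (List A) λ rest → xs ↭ toList v ++ rest

  mutual
    splits : (k : ℕ) (xs : List A) → List (Split k xs)
    splits zero    xs = [ ([] , xs , ↭-refl) ]
    splits (suc k) xs = concatMap (splitsAfter k) (picks xs)

    splitsAfter : ∀ k {xs} → Pick xs → List (Split (suc k) xs)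
    splitsAfter k (y , ys , p) = map (λ { (v , rest , q) → y ∷ v , rest , ↭-trans p (prep y q) }) (splits k ys)

  splits-complete : ∀ k {xs} (v : Vec A k) {rest} → xs ↭ toList v ++ rest →
                    Any (λ s → proj₁ s ≡ v × proj₁ (proj₂ s) ↭ rest) (splits k xs)
  splits-complete zero    []      p = here (refl , p)
  splits-complete (suc k) (y ∷ v) p =
    Any.concatMap⁺ (splitsAfter k) (Any.map (λ {e} → after-y {e}) (picks-complete (∈-resp-↭ (↭-sym p) (here refl))))
    where
    after-y : ∀ {e} → proj₁ e ≡ y → Any (λ s → proj₁ s ≡ y ∷ v × proj₁ (proj₂ s) ↭ _) (splitsAfter k e)
    after-y {y , ys , q} refl =
      Any.map⁺ (Any.map (λ { (refl , rest↭) → refl , rest↭ }) (splits-complete k v (drop-∷ (↭-trans (↭-sym q) p))))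

  Split₂ : ℕ → ℕ → List A → Set
  Split₂ p n xs = Σ (Vec A p × Vec A n) λ (u , v) → Σ (List A) λ rest → xs ↭ toList u ++ toList v ++ rest

  splits₂ : (p n : ℕ) (xs : List A) → List (Split₂ p n xs)
  splits₂ p n xs = concatMap splitRest (splits p xs)
    where
    splitRest : Split p xs → List (Split₂ p n xs)
    splitRest (u , ys , q) = map (λ { (v , rest , q′) → (u , v) , rest , ↭-trans q (++⁺ˡ (toList u) q′) }) (splits n ys)

  splits₂-complete : ∀ p n {xs} (u : Vec A p) (v : Vec A n) {rest} → xs ↭ toList u ++ toList v ++ rest →
                     Any (λ s → proj₁ s ≡ (u , v)) (splits₂ p n xs)
  splits₂-complete p n u v h =
    Any.concatMap⁺ _ (Any.map (λ { {_ , ys , _} (refl , ys↭) → Any.map⁺ (Any.map (λ { (refl , _) → refl })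
                                   (splits-complete n v ys↭)) })
                              (splits-complete p u h))

  vecsOver : List A → (k : ℕ) → List (Vec A k)
  vecsOver cs zero    = [ [] ]
  vecsOver cs (suc k) = concatMap (λ c → map (c ∷_) (vecsOver cs k)) cs

  ∈-vecsOver : ∀ {cs k} (v : Vec A k) → (∀ i → lookup v i ∈ cs) → v ∈ vecsOver cs k
  ∈-vecsOver []      _  = here refl
  ∈-vecsOver (c ∷ v) v⊆cs =
    ∈-concatMap⁺ (λ c → map (c ∷_) (vecsOver _ _))
      (Any.map (λ { refl → ∈-map⁺ (c ∷_) (∈-vecsOver v (v⊆cs ∘ fsuc)) }) (v⊆cs fzero))

open Enumeration

mutual
  _≟ᵗ_ : (t u : GTerm) → Dec (t ≡ u)
  var m    ≟ᵗ var n    = map′ (cong var) (λ { refl → refl }) (m ℕ.≟ n)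
  con c    ≟ᵗ con d    = map′ (cong con) (λ { refl → refl }) (c ℕ.≟ d)
  fun f ts ≟ᵗ fun g us = map′ (λ { (refl , refl) → refl }) (λ { refl → refl , refl }) (f ℕ.≟ g ×-dec ts ≟ᵗˢ us)
  var _    ≟ᵗ con _    = no λ ()
  var _    ≟ᵗ fun _ _  = no λ ()
  con _    ≟ᵗ var _    = no λ ()
  con _    ≟ᵗ fun _ _  = no λ ()
  fun _ _  ≟ᵗ var _    = no λ ()
  fun _ _  ≟ᵗ con _    = no λ ()

  _≟ᵗˢ_ : (ts us : List GTerm) → Dec (ts ≡ us)
  []       ≟ᵗˢ []       = yes refl
  (t ∷ ts) ≟ᵗˢ (u ∷ us) = map′ (λ { (refl , refl) → refl }) (λ { refl → refl , refl }) (t ≟ᵗ u ×-dec ts ≟ᵗˢ us)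
  []       ≟ᵗˢ (_ ∷ _)  = no λ ()
  (_ ∷ _)  ≟ᵗˢ []       = no λ ()

_≟ᶠ_ : (f g : GFact) → Dec (f ≡ g)
fact P us ≟ᶠ fact Q vs = map′ (λ { (refl , refl) → refl }) (λ { refl → refl , refl }) (P ℕ.≟ Q ×-dec us ≟ᵗˢ vs)

open import Data.List.Membership.DecPropositional _≟ᵗ_ using (_∈?_)

mutual
  subterms : GTerm → List GTerm
  subterms t = t ∷ argumentSubterms t

  argumentSubterms : GTerm → List GTerm
  argumentSubterms (fun f ts) = subtermsˡ ts
  argumentSubterms _          = []

  subtermsˡ : List GTerm → List GTerm
  subtermsˡ []       = []
  subtermsˡ (t ∷ ts) = subterms t ++ subtermsˡ ts

subtermsᶠ : GFact → List GTerm
subtermsᶠ (fact P us) = subtermsˡ us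

module _ {V : Set} (σ σ′ : V → GTerm) where

  mutual
    subT-cong-on : ∀ t → (∀ v → σ v ∈ subterms (subT σ t) → σ′ v ≡ σ v) → subT σ′ t ≡ subT σ t
    subT-cong-on (var v)    agree = agree v (here refl)
    subT-cong-on (con c)    agree = refl
    subT-cong-on (fun f ts) agree = cong (fun f) (subL-cong-on ts λ v → agree v ∘ there)

    subL-cong-on : ∀ ts → (∀ v → σ v ∈ subtermsˡ (subL σ ts) → σ′ v ≡ σ v) → subL σ′ ts ≡ subL σ ts
    subL-cong-on []       agree = refl
    subL-cong-on (t ∷ ts) agree =
      cong₂ _∷_ (subT-cong-on t  λ v → agree v ∘ ∈-++⁺ˡ)
                (subL-cong-on ts λ v → agree v ∘ ∈-++⁺ʳ (subterms (subT σ t)))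

  subF-cong-on : ∀ f → (∀ v → σ v ∈ subtermsᶠ (subF σ f) → σ′ v ≡ σ v) → subF σ′ f ≡ subF σ f
  subF-cong-on (fact P us) = cong (fact P) ∘ subL-cong-on us

Matches : {V : Set} → (V → GTerm) → List (Fact V × GFact) → Set
Matches σ = All (λ e → subF σ (proj₁ e) ≡ proj₂ e)

module Matching {nv : ℕ} (ps : List (Fact (Fin nv) × GFact)) where

  -- a matcher may as well send every variable to a subterm of the targets (or to a dummy)
  candidates : List GTerm
  candidates = con 0 ∷ concatMap (subtermsᶠ ∘ proj₂) ps

  trim : (Fin nv → GTerm) → Fin nv → GTerm
  trim σ i with σ i ∈? candidates
  ... | yes _ = σ i
  ... | no  _ = con 0

  trim-∈ : ∀ σ i → trim σ i ∈ candidates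
  trim-∈ σ i with σ i ∈? candidates
  ... | yes σi∈ = σi∈
  ... | no  _   = here refl

  trim-agrees : ∀ σ i → σ i ∈ candidates → trim σ i ≡ σ i
  trim-agrees σ i σi∈ with σ i ∈? candidates
  ... | yes _   = refl
  ... | no  σi∉ = contradiction σi∈ σi∉

  trim-matches : ∀ {σ} → Matches σ ps → Matches (lookup (tabulate (trim σ))) ps
  trim-matches {σ} m = All.tabulate λ {e} e∈ps →
    let σe≡ = All.lookup m e∈ps in
    trans (subF-cong-on σ _ (proj₁ e) λ i s →
            trans (lookup∘tabulate (trim σ) i)
                  (trim-agrees σ i (there (∈-concatMap⁺ (subtermsᶠ ∘ proj₂)
                                            (lose e∈ps (subst (λ g → σ i ∈ subtermsᶠ g) σe≡ s))))))
          σe≡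

  match? : Dec (∃ λ σ → Matches σ ps)
  match? = map′ (λ found → let v , m = Any.satisfied found in lookup v , m)
                (λ (σ , m) → lose (∈-vecsOver (tabulate (trim σ)) (λ i →
                                     subst (_∈ candidates) (sym (lookup∘tabulate (trim σ) i)) (trim-∈ σ i)))
                                  (trim-matches m))
                (any? (λ v → All.all? (λ e → subF (lookup v) (proj₁ e) ≟ᶠ proj₂ e) ps) (vecsOver candidates nv))

open Matching using (match?)

mutual
  nonceBoundᵗ : GTerm → ℕ
  nonceBoundᵗ (var m)    = m
  nonceBoundᵗ (con _)    = 0
  nonceBoundᵗ (fun _ ts) = nonceBoundˡ ts

  nonceBoundˡ : List GTerm → ℕ
  nonceBoundˡ []       = 0
  nonceBoundˡ (t ∷ ts) = nonceBoundᵗ t ⊔ nonceBoundˡ ts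

nonceBound : List TFact → ℕ
nonceBound []                   = 0
nonceBound ((fact _ us , _) ∷ fs) = nonceBoundˡ us ⊔ nonceBound fs

mutual
  OccT⇒≤nonceBound : ∀ {m} t → OccT m t → m ≤ nonceBoundᵗ t
  OccT⇒≤nonceBound (var _)    refl = ℕ.≤-refl
  OccT⇒≤nonceBound (fun _ ts) occ  = OccL⇒≤nonceBound ts occ

  OccL⇒≤nonceBound : ∀ {m} ts → OccL m ts → m ≤ nonceBoundˡ ts
  OccL⇒≤nonceBound (t ∷ ts) (inj₁ occ) = ℕ.≤-trans (OccT⇒≤nonceBound t occ) (ℕ.m≤m⊔n _ _)
  OccL⇒≤nonceBound (t ∷ ts) (inj₂ occ) = ℕ.≤-trans (OccL⇒≤nonceBound ts occ) (ℕ.m≤n⊔m _ _)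

Occ⇒≤nonceBound : ∀ {m} fs → Any (OccF m) fs → m ≤ nonceBound fs
Occ⇒≤nonceBound ((fact _ us , _) ∷ fs) (here occ)  = ℕ.≤-trans (OccL⇒≤nonceBound us occ) (ℕ.m≤m⊔n _ _)
Occ⇒≤nonceBound ((fact _ us , _) ∷ fs) (there occ) = ℕ.≤-trans (Occ⇒≤nonceBound fs occ) (ℕ.m≤n⊔m _ _)

freshNonces : ∀ {k} → Config → Fin k → Nonce
freshNonces S x = suc (nonceBound (facts S) + toℕ x)

freshNonces-injective : ∀ {k} S → Injective _≡_ _≡_ (freshNonces {k} S)
freshNonces-injective S = Fin.toℕ-injective ∘ ℕ.+-cancelˡ-≡ (nonceBound (facts S)) _ _ ∘ ℕ.suc-injective

freshNonces-fresh : ∀ {k} S (x : Fin k) → ¬ OccC (freshNonces S x) S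
freshNonces-fresh S x occ =
  ℕ.<⇒≱ (ℕ.s≤s (ℕ.m≤m+n (nonceBound (facts S)) (toℕ x))) (Occ⇒≤nonceBound (facts S) occ)

holds? : {A : Set} (τ : A → ℕ) (c : Constraint A) → Dec (Holds τ c)
holds? τ (constr gt a b plus  d) = τ b + d <? τ a
holds? τ (constr gt a b minus d) = τ b <? τ a + d
holds? τ (constr eq a b plus  d) = τ a ℕ.≟ τ b + d
holds? τ (constr eq a b minus d) = τ a + d ℕ.≟ τ b

Holds-resp : {A : Set} {τ τ′ : A → ℕ} → τ ≗ τ′ → ∀ {c} → Holds τ c → Holds τ′ c
Holds-resp τ≗τ′ {constr gt a b plus  d} rewrite τ≗τ′ a | τ≗τ′ b = id
Holds-resp τ≗τ′ {constr gt a b minus d} rewrite τ≗τ′ a | τ≗τ′ b = id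
Holds-resp τ≗τ′ {constr eq a b plus  d} rewrite τ≗τ′ a | τ≗τ′ b = id
Holds-resp τ≗τ′ {constr eq a b minus d} rewrite τ≗τ′ a | τ≗τ′ b = id

≥c⇒≤ : {A : Set} {τ : A → ℕ} {a b : A} → Holds τ (a ≥c b) → τ b ≤ τ a
≥c⇒≤ {τ = τ} {a} {b} h = ℕ.m<1+n⇒m≤n (subst (τ b <_) (ℕ.+-comm (τ a) 1) h)

timedInstᵛ : {V : Set} {k : ℕ} → (V → GTerm) → Vec (Fact V) k → Vec ℕ k → Vec TFact k
timedInstᵛ σ fs ts = zipWith (λ f t → subF σ f , t) fs ts

patterns : {V : Set} {k : ℕ} → Vec (Fact V) k → Vec TFact k → List (Fact V × GFact)
patterns fs v = toList (zipWith (λ f x → f , proj₁ x) fs v)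

module _ {V : Set} (σ : V → GTerm) where

  matches⇒timedInst : ∀ {k} (fs : Vec (Fact V) k) v →
                      Matches σ (patterns fs v) → timedInstᵛ σ fs (Vec.map proj₂ v) ≡ v
  matches⇒timedInst []       []            []       = refl
  matches⇒timedInst (f ∷ fs) ((g , t) ∷ v) (m ∷ ms) = cong₂ _∷_ (cong (_, t) m) (matches⇒timedInst fs v ms)

  timedInst-matches : ∀ {k} (fs : Vec (Fact V) k) ts → Matches σ (patterns fs (timedInstᵛ σ fs ts))
  timedInst-matches []       []       = []
  timedInst-matches (f ∷ fs) (t ∷ ts) = refl ∷ timedInst-matches fs ts

  timestamps-timedInst : ∀ {k} (fs : Vec (Fact V) k) ts → Vec.map proj₂ (timedInstᵛ σ fs ts) ≡ ts
  timestamps-timedInst []       []       = refl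
  timestamps-timedInst (f ∷ fs) (t ∷ ts) = cong (t ∷_) (timestamps-timedInst fs ts)

timing : ∀ {p n} → ℕ → Vec ℕ p → Vec ℕ n → TVar p n → ℕ
timing T tw tf tT     = T
timing T tw tf (tW i) = lookup tw i
timing T tw tf (tF i) = lookup tf i

module Applicability (r : Rule) (S : Config) where

  Fits : Split₂ (p r) (n r) (facts S) → Set
  Fits ((u , v) , _) =
    (∃ λ σ → Matches σ (patterns (W r) u ++ patterns (F r) v))
    × All (Holds (timing (time S) (Vec.map proj₂ u) (Vec.map proj₂ v))) (C r)

  fits? : ∀ s → Dec (Fits s)
  fits? ((u , v) , _) = match? _ ×-dec All.all? (holds? _) (C r)

  fits⇒application : ∀ s → Fits s → ∃ (Application r S)
  fits⇒application ((u , v) , rest , arranged) ((σ , m) , cs) =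
    ⟪ time S , timedInst σ (W r) (Vec.map proj₂ u) ++ map created (Q r) ++ rest ⟫ , record
      { σ = σ ; ξ = freshNonces S ; tw = Vec.map proj₂ u ; tf = Vec.map proj₂ v ; rest = rest
      ; fresh-inj = freshNonces-injective S
      ; fresh = freshNonces-fresh S
      ; constraints = All.map (Holds-resp λ { tT → refl ; (tW _) → refl ; (tF _) → refl }) cs
      ; pre = subst₂ (λ u′ v′ → facts S ↭ toList u′ ++ toList v′ ++ rest)
                     (sym (matches⇒timedInst σ (W r) u (All.++⁻ˡ _ m)))
                     (sym (matches⇒timedInst σ (F r) v (All.++⁻ʳ _ m)))
                     arranged
      ; time≡ = refl
      ; post = ↭-reflexive (cong (λ qs → timedInst σ (W r) (Vec.map proj₂ u) ++ qs ++ rest)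
                                 (List.map-cong (λ _ → refl) (Q r))) }
    where
    created : Fact (Fin (nv r) ⊎ Fin (nx r)) × ℕ → TFact
    created (q , d) = subF Sum.[ σ , var ∘ freshNonces S ] q , time S + d

  application⇒fits : ∀ {S′} → Application r S S′ → Any Fits (splits₂ (p r) (n r) (facts S))
  application⇒fits ap =
    Any.map (λ { {_ , _} refl → fits })
            (splits₂-complete (p r) (n r) (timedInstᵛ σ (W r) tw) (timedInstᵛ σ (F r) tf) pre)
    where
    open Application ap
    fits : Fits ((timedInstᵛ σ (W r) tw , timedInstᵛ σ (F r) tf) , rest , pre)
    fits = (σ , All.++⁺ (timedInst-matches σ (W r) tw) (timedInst-matches σ (F r) tf))
         , All.map (Holds-resp λ { tT → refl
                                 ; (tW i) → cong (λ ts → lookup ts i) (sym (timestamps-timedInst σ (W r) tw))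
                                 ; (tF i) → cong (λ ts → lookup ts i) (sym (timestamps-timedInst σ (F r) tf)) })
                   constraints

  applicable? : Dec (∃ (Application r S))
  applicable? = map′ (λ found → let s , fit = Any.satisfied found in fits⇒application s fit)
                     (λ (_ , ap) → application⇒fits ap)
                     (any? fits? (splits₂ (p r) (n r) (facts S)))

instApplicable? : ∀ R S → Dec (InstApplicable R S)
instApplicable? R S = map′ fromAny toAny (any? (λ r → Applicability.applicable? r S) R)
  where
  fromAny : Any (λ r → ∃ (Application r S)) R → InstApplicable R S
  fromAny found = let r , r∈R , S′ , ap = find found in S′ , r , r∈R , ap

  toAny : InstApplicable R S → Any (λ r → ∃ (Application r S)) R
  toAny (S′ , r , r∈R , ap) = lose r∈R (S′ , ap)

due? : (T : ℕ) (x : TFact) → Dec (proj₂ x ≤ T)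
due? T x = proj₂ x ≤? T

dueCount : ℕ → List TFact → ℕ
dueCount T xs = length (filter (due? T) xs)

dueCount-↭ : ∀ T {xs ys} → xs ↭ ys → dueCount T xs ≡ dueCount T ys
dueCount-↭ T xs↭ys = ↭-length (filter-↭ (due? T) xs↭ys)

dueCount-++ : ∀ T xs ys → dueCount T (xs ++ ys) ≡ dueCount T xs + dueCount T ys
dueCount-++ T xs ys = trans (cong length (List.filter-++ (due? T) xs ys)) (List.length-++ (filter (due? T) xs))

dueNow : Config → ℕ
dueNow S = dueCount (time S) (facts S)

dueCount-delayed : ∀ T {B : Set} (created : B → TFact) (delay : B → ℕ) (qs : List B) →
                   (∀ q → proj₂ (created q) ≡ T + delay q) → Any (λ q → 1 ≤ delay q) qs →
                   dueCount T (map created qs) < length qs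
dueCount-delayed T created delay qs stamp late =
  subst (dueCount T (map created qs) <_) (List.length-map created qs)
        (List.filter-notAll (due? T) (map created qs)
           (Any.map⁺ (Any.map (λ {q} 1≤d → ℕ.<⇒≱ (subst (T <_) (sym (stamp q)) (ℕ.m<m+n T 1≤d))) late)))

timedInst-bounded : ∀ {V : Set} {k T} (σ : V → GTerm) (fs : Vec (Fact V) k) ts →
                    (∀ i → lookup ts i ≤ T) → All (λ x → proj₂ x ≤ T) (timedInst σ fs ts)
timedInst-bounded σ []       []       ts≤T = []
timedInst-bounded σ (f ∷ fs) (t ∷ ts) ts≤T = ts≤T fzero ∷ timedInst-bounded σ fs ts (ts≤T ∘ fsuc)

dueCount-bounded : ∀ {V : Set} {k} T (σ : V → GTerm) (fs : Vec (Fact V) k) ts →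
                   (∀ i → lookup ts i ≤ T) → dueCount T (timedInst σ fs ts) ≡ k
dueCount-bounded T σ fs ts ts≤T =
  trans (cong length (List.filter-all (due? T) (timedInst-bounded σ fs ts ts≤T)))
        (Vec.length-toList (timedInstᵛ σ fs ts))

-- Consumed facts are all due (T ≥ T′ᵢ) while some created fact lies in the future (dᵢ ≥ 1);
-- balance makes the two lists equally long.
instStep-decreases : ∀ {R S S′} → IsPTS R → InstStep R S S′ → dueNow S′ < dueNow S
instStep-decreases {S = S} {S′} (balanced , progressing) (r , r∈R , ap) = begin-strict
  dueNow S′                                         ≡⟨ cong (λ t → dueCount t (facts S′)) time≡ ⟩
  dueCount T (facts S′)                             ≡⟨ dueCount-↭ T post ⟩
  dueCount T (Wᵢ ++ Qᵢ ++ rest)                     ≡⟨ dueCount-++ T Wᵢ _ ⟩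
  dueCount T Wᵢ + dueCount T (Qᵢ ++ rest)           ≡⟨ cong (dueCount T Wᵢ +_) (dueCount-++ T Qᵢ rest) ⟩
  dueCount T Wᵢ + (dueCount T Qᵢ + dueCount T rest) <⟨ ℕ.+-monoʳ-< (dueCount T Wᵢ) (ℕ.+-monoˡ-< (dueCount T rest) created<) ⟩
  dueCount T Wᵢ + (n r + dueCount T rest)           ≡⟨ cong (λ k → dueCount T Wᵢ + (k + dueCount T rest)) consumed ⟨
  dueCount T Wᵢ + (dueCount T Fᵢ + dueCount T rest) ≡⟨ cong (dueCount T Wᵢ +_) (dueCount-++ T Fᵢ rest) ⟨
  dueCount T Wᵢ + dueCount T (Fᵢ ++ rest)           ≡⟨ dueCount-++ T Wᵢ _ ⟨
  dueCount T (Wᵢ ++ Fᵢ ++ rest)                     ≡⟨ dueCount-↭ T pre ⟨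
  dueNow S                                          ∎
  where
  open Application ap
  open ℕ.≤-Reasoning

  T : ℕ
  T = time S

  Wᵢ Fᵢ Qᵢ : List TFact
  Wᵢ = timedInst σ (W r) tw
  Fᵢ = timedInst σ (F r) tf
  Qᵢ = map _ (Q r)

  consumed : dueCount T Fᵢ ≡ n r
  consumed = dueCount-bounded T σ (F r) tf λ i →
    ≥c⇒≤ {τ = timing T tw tf} {tT} {tF i} (All.lookup constraints (proj₂ (All.lookup progressing r∈R) i))

  created< : dueCount T Qᵢ < n r
  created< = subst (dueCount T Qᵢ <_) (All.lookup balanced r∈R)
                   (dueCount-delayed T _ proj₂ (Q r) (λ _ → refl) (proj₁ (All.lookup progressing r∈R)))

module GreedyRun {R : System} (pts : IsPTS R) where

  lazyNext : ∀ S → Σ Config (LazyStep R S)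
  lazyNext S with instApplicable? R S
  ... | yes (S′ , st) = S′ , inst st , λ ()
  ... | no  stuck     = ⟪ suc (time S) , facts S ⟫ , tick , λ _ → stuck

  next : Config → Config
  next S = proj₁ (lazyNext S)

  next-cases : ∀ S → (∃ λ S′ → InstStep R S S′ × next S ≡ S′) ⊎ next S ≡ ⟪ suc (time S) , facts S ⟫
  next-cases S with instApplicable? R S
  ... | yes (S′ , st) = inj₁ (S′ , st , refl)
  ... | no  _         = inj₂ refl

  greedy : Config → ℕ → Config
  greedy S zero    = S
  greedy S (suc i) = greedy (next S) i

  greedy-lazy : ∀ S → LazyRun R S (greedy S)
  greedy-lazy S = refl , steps S
    where
    steps : ∀ S i → LazyStep R (greedy S i) (greedy S (suc i))
    steps S zero    = proj₂ (lazyNext S)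
    steps S (suc i) = steps (next S) i

  greedy-+ : ∀ S k i → greedy S (k + i) ≡ greedy (greedy S k) i
  greedy-+ S zero    i = refl
  greedy-+ S (suc k) i = greedy-+ (next S) k i

  greedy-ticks : ∀ S → ∃ λ k → time S < time (greedy S k)
  greedy-ticks S = go S (<-wellFounded (dueNow S))
    where
    go : ∀ S → Acc _<_ (dueNow S) → ∃ λ k → time S < time (greedy S k)
    go S (acc smaller) with next-cases S
    ... | inj₂ ticked = 1 , subst (λ S′ → time S < time S′) (sym ticked) (ℕ.n<1+n (time S))
    ... | inj₁ (S′ , st@(_ , _ , ap) , stepped) =
      let k , later = go S′ (smaller (instStep-decreases pts st)) in
      suc k , subst (λ X → time S < time (greedy X k)) (sym stepped)
                    (subst (_< time (greedy S′ k)) (Application.time≡ ap) later)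

  greedy-unbounded : ∀ S → InfiniteTime (greedy S)
  greedy-unbounded S zero    = let k , later = greedy-ticks S in k , ℕ.≤-<-trans ℕ.z≤n later
  greedy-unbounded S (suc m) =
    let i , m<t = greedy-unbounded S m
        k , later = greedy-ticks (greedy S i)
    in i + k , subst (λ X → suc m < time X) (sym (greedy-+ S i k)) (ℕ.≤-<-trans m<t later)

lazyInfiniteRun : ∀ {R} → IsPTS R → ∀ S → ∃ λ ρ → LazyRun R S ρ × InfiniteTime ρ
lazyInfiniteRun pts S = greedy S , greedy-lazy S , greedy-unbounded S
  where open GreedyRun pts

AllLazyRunsCompliant : System → CritSpec → Config → Set
AllLazyRunsCompliant R CS S = ∀ ρ → LazyRun R S ρ → InfiniteTime ρ → CompliantRun CS ρ

allLazyRunsCompliant-step : ∀ {R CS S S′} → AllLazyRunsCompliant R CS S → LazyStep R S S′ →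
                            AllLazyRunsCompliant R CS S′
allLazyRunsCompliant-step {R} {S = S} compliant st ρ (ρ0≡S′ , steps) unbounded i =
  compliant S◂ρ (refl , steps′) (λ m → let j , m<t = unbounded m in suc j , m<t) (suc i)
  where
  S◂ρ : ℕ → Config
  S◂ρ zero    = S
  S◂ρ (suc i) = ρ i

  steps′ : ∀ i → LazyStep R (S◂ρ i) (S◂ρ (suc i))
  steps′ zero    = subst (LazyStep R S) (sym ρ0≡S′) st
  steps′ (suc i) = steps i

allLazyRunsCompliant-reach : ∀ {R CS S0 S} → AllLazyRunsCompliant R CS S0 → CompliantReach R CS S0 S →
                             AllLazyRunsCompliant R CS S
allLazyRunsCompliant-reach compliant (start _)         = compliant
allLazyRunsCompliant-reach compliant (step reach st _) =
  allLazyRunsCompliant-step (allLazyRunsCompliant-reach compliant reach) st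

S⇒L : ∀ R S0 CS → IsPTS R → SProp R S0 CS → LProp R S0 CS
S⇒L R S0 CS pts (z , compliant) = z , λ S reach →
  let ρ , lazy , unbounded = lazyInfiniteRun pts S in
  ρ , lazy , unbounded , allLazyRunsCompliant-reach compliant reach ρ lazy unbounded

-- A@0 may become either C@1 or D@1, and D is critical: the lazy run choosing D breaks S, but
-- a compliant run can only have chosen C, after which nothing but Tick is possible.
module Counterexample where

  atom : {V : Set} → ℕ → Fact V
  atom c = fact c []

  -- A@T′ ∣ T ≥ T′ → c@(T + 1); the predicates 0, 1, 2 play the roles of A, C, D
  replaceA : ℕ → Rule
  replaceA c = record
    { nv = 0 ; nx = 0 ; p = 0 ; n = 1 ; W = [] ; F = atom 0 ∷ []
    ; C = (tT ≥c tF fzero) ∷ [] ; Q = (atom c , 1) ∷ [] }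

  system : System
  system = replaceA 1 ∷ replaceA 2 ∷ []

  initial : Config
  initial = ⟪ 0 , (atom 0 , 0) ∷ [] ⟫

  critical : CritSpec
  critical = record { cnv = 0 ; k = 1 ; cfacts = atom 2 ∷ [] ; cC = [] } ∷ []

  system-pts : IsPTS system
  system-pts = refl ∷ refl ∷ [] , replaceA-progressing ∷ replaceA-progressing ∷ []
    where
    replaceA-progressing : ∀ {c} → Any (λ q → 1 ≤ proj₂ q) (Q (replaceA c))
                                 × (∀ i → (tT ≥c tF i) ∈ C (replaceA c))
    replaceA-progressing = here (ℕ.s≤s ℕ.z≤n) , λ { fzero → here refl }

  Has : ℕ → List TFact → Set
  Has c fs = ∃ λ t → (atom c , t) ∈ fs

  Only : ℕ → List TFact → Set
  Only d = All (λ x → proj₁ x ≡ atom d)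

  Only⇒¬Has : ∀ {c d fs} → c ≢ d → Only d fs → ¬ Has c fs
  Only⇒¬Has c≢d only (_ , x∈fs) with All.lookup only x∈fs
  ... | refl = c≢d refl

  critical⇒Has₂ : ∀ {S} → Critical critical S → Has 2 (facts S)
  critical⇒Has₂ (here (_ , t ∷ [] , _ , arranged , _)) = t , ∈-resp-↭ (↭-sym arranged) (here refl)

  application⇒Has₀ : ∀ {c S S′} → Application (replaceA c) S S′ → Has 0 (facts S)
  application⇒Has₀ ap with Application.tw ap | Application.tf ap | Application.pre ap
  ... | [] | t ∷ [] | arranged = t , ∈-resp-↭ (↭-sym arranged) (here refl)

  stuck : ∀ {S} → ¬ Has 0 (facts S) → ¬ InstApplicable system S
  stuck noA (_ , _ , here refl         , ap) = noA (application⇒Has₀ ap)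
  stuck noA (_ , _ , there (here refl) , ap) = noA (application⇒Has₀ ap)

  Only₁-stuck : ∀ {S} → Only 1 (facts S) → ¬ InstApplicable system S
  Only₁-stuck only = stuck (Only⇒¬Has (λ ()) only)

  Only₁-compliant : ∀ {S} → Only 1 (facts S) → ¬ Critical critical S
  Only₁-compliant only = Only⇒¬Has (λ ()) only ∘ critical⇒Has₂

  initial-applies : ∀ c → Application (replaceA c) initial ⟪ 0 , (atom c , 1) ∷ [] ⟫
  initial-applies c = record
    { σ = λ () ; ξ = λ () ; tw = [] ; tf = 0 ∷ [] ; rest = []
    ; fresh-inj = λ { {()} } ; fresh = λ ()
    ; constraints = ℕ.s≤s ℕ.z≤n ∷ [] ; pre = ↭-refl ; time≡ = refl ; post = ↭-refl }

  initial-application : ∀ {c S′} → Application (replaceA c) initial S′ → facts S′ ↭ (atom c , 1) ∷ []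
  initial-application ap with Application.tw ap | Application.tf ap | Application.rest ap
                            | Application.pre ap | Application.post ap
  ... | [] | _ ∷ [] | []    | _        | created = created
  ... | [] | _ ∷ [] | _ ∷ _ | arranged | _ with ↭-length arranged
  ...   | ()

  replaceThenTick : ℕ → ℕ → Config
  replaceThenTick c zero    = initial
  replaceThenTick c (suc i) = ⟪ i , (atom c , 1) ∷ [] ⟫

  replaceThenTick-lazy : ∀ c → replaceA c ∈ system → c ≢ 0 → LazyRun system initial (replaceThenTick c)
  replaceThenTick-lazy c c∈system c≢0 = refl , steps
    where
    steps : ∀ i → LazyStep system (replaceThenTick c i) (replaceThenTick c (suc i))
    steps zero    = inst (replaceA c , c∈system , initial-applies c) , λ ()
    steps (suc i) = tick , λ _ → stuck (Only⇒¬Has (c≢0 ∘ sym) (refl ∷ []))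

  replaceThenTick-unbounded : ∀ c → InfiniteTime (replaceThenTick c)
  replaceThenTick-unbounded c m = suc (suc m) , ℕ.≤-refl

  Z-holds : ZProp system initial critical
  Z-holds = replaceThenTick 1 , replaceThenTick-lazy 1 (here refl) (λ ()) , replaceThenTick-unbounded 1 , compliant
    where
    compliant : CompliantRun critical (replaceThenTick 1)
    compliant zero    = Only⇒¬Has (λ ()) (refl ∷ []) ∘ critical⇒Has₂
    compliant (suc i) = Only₁-compliant (refl ∷ [])

  ¬S-holds : ¬ SProp system initial critical
  ¬S-holds (_ , compliant) =
    compliant (replaceThenTick 2) (replaceThenTick-lazy 2 (there (here refl)) (λ ())) (replaceThenTick-unbounded 2)
              1 (here ((λ ()) , 1 ∷ [] , [] , ↭-refl , []))

  reachable : ∀ {S} → CompliantReach system critical initial S → S ≡ initial ⊎ Only 1 (facts S)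
  reachable (start _) = inj₁ refl
  reachable (step reach st compliant) with reachable reach | st
  ... | inj₁ refl | tick , lazy =
    contradiction (_ , _ , here refl , initial-applies 1) (lazy _)
  ... | inj₁ refl | inst (_ , here refl , ap) , _ =
    inj₂ (All-resp-↭ (↭-sym (initial-application ap)) (refl ∷ []))
  ... | inj₁ refl | inst (_ , there (here refl) , ap) , _ =
    contradiction (here ((λ ()) , 1 ∷ [] , [] , initial-application ap , [])) compliant
  ... | inj₂ only | tick , _     = inj₂ only
  ... | inj₂ only | inst st′ , _ = contradiction (_ , st′) (Only₁-stuck only)

  tickForever : ∀ S → Only 1 (facts S) → ZProp system S critical
  tickForever S only =
    (λ i → ⟪ i + time S , facts S ⟫) ,
    (refl , λ i → tick , λ _ → Only₁-stuck only) ,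
    (λ m → suc m , ℕ.s≤s (ℕ.m≤m+n m (time S))) ,
    (λ i → Only₁-compliant only)

  L-holds : LProp system initial critical
  L-holds = Z-holds , λ S reach → Sum.[ (λ { refl → Z-holds }) , tickForever S ] (reachable reach)

proposition9 :
    (∀ (R : System) (S0 : Config) (CS : CritSpec) →
       IsPTS R → SProp R S0 CS → LProp R S0 CS)
    × Σ System (λ R → Σ Config (λ S0 → Σ CritSpec (λ CS →
        IsPTS R × LProp R S0 CS × ¬ SProp R S0 CS)))
proposition9 = S⇒L , system , initial , critical , system-pts , L-holds , ¬S-holds
  where open Counterexample
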